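{- Let $G$ be a connected non-complete graph. If $\mu_t(G)= {\rm n}(G)-{\rm diam}(G)+1$, then $\gamma_c(G)={\rm diam}(G)-1$.
   Context: All graphs are finite, simple and undirected. ${\rm n}(G)$ is the order, ${\rm diam}(G)$ the diameter, and $\gamma_c(G)$ the connected domination number (minimum cardinality of a dominating set inducing a connected subgraph) of $G$. For $X\subseteq V(G)$, two vertices $x,y\in V(G)$ are $X$-visible if there is a shortest $x,y$-path in $G$ none of whose internal vertices lies in $X$. $X$ is a total mutual-visibility set of $G$ if every two vertices of $G$ are $X$-visible; $\mu_t(G)$ is the maximum cardinality of such a set. -}

module Defs where

open import Data.Nat using (ℕ; zero; suc; _≤_)
open import Data.Fin using (Fin)
open import Data.Fin.Subset using (Subset; _∈_; _∉_; ∣_∣)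
open import Data.List using (List; []; _∷_)
open import Data.List.Relation.Unary.All using (All)
open import Data.Product using (Σ; ∃; ∃-syntax; _×_; _,_)
open import Data.Sum using (_⊎_)
open import Relation.Nullary using (¬_; Dec)
open import Relation.Binary.PropositionalEquality using (_≡_; _≢_)

record Graph (n : ℕ) : Set₁ where
  field
    _~_    : Fin n → Fin n → Set
    ~-dec  : ∀ x y → Dec (x ~ y)
    ~-sym  : ∀ {x y} → x ~ y → y ~ x
    ~-irr  : ∀ {x} → ¬ (x ~ x)

module _ {n : ℕ} (G : Graph n) where
  open Graph G

  data Walk : Fin n → Fin n → ℕ → Set where
    here : ∀ {x} → Walk x x 0
    step : ∀ {x y z k} → x ~ y → Walk y z k → Walk x z (suc k)

  verts : ∀ {x y k} → Walk x y k → List (Fin n)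
  verts (here {x}) = x ∷ []
  verts (step {x} _ w) = x ∷ verts w

  initVerts : ∀ {x y k} → Walk x y k → List (Fin n)
  initVerts here = []
  initVerts (step {x} _ w) = x ∷ initVerts w

  internal : ∀ {x y k} → Walk x y k → List (Fin n)
  internal here = []
  internal (step _ w) = initVerts w

  IsDist : Fin n → Fin n → ℕ → Set
  IsDist x y d = Walk x y d × (∀ k → Walk x y k → d ≤ k)

  Connected : Set
  Connected = ∀ x y → ∃[ k ] Walk x y k

  NonComplete : Set
  NonComplete = ∃[ x ] ∃[ y ] (x ≢ y × ¬ (x ~ y))

  IsDiam : ℕ → Set
  IsDiam D = (∃[ x ] ∃[ y ] IsDist x y D)
           × (∀ x y d → IsDist x y d → d ≤ D)

  Visible : Subset n → Fin n → Fin n → Set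
  Visible X x y = ∃[ d ] Σ (Walk x y d) λ w →
                    (∀ k → Walk x y k → d ≤ k) × All (_∉ X) (internal w)

  IsTotalMutualVisibility : Subset n → Set
  IsTotalMutualVisibility X = ∀ x y → Visible X x y

  IsMuT : ℕ → Set
  IsMuT m = (∃[ X ] (IsTotalMutualVisibility X × ∣ X ∣ ≡ m))
          × (∀ X → IsTotalMutualVisibility X → ∣ X ∣ ≤ m)

  Dominating : Subset n → Set
  Dominating X = ∀ v → v ∈ X ⊎ (∃[ u ] (u ∈ X × u ~ v))

  InducesConnected : Subset n → Set
  InducesConnected X = ∀ x y → x ∈ X → y ∈ X →
                         ∃[ k ] Σ (Walk x y k) λ w → All (_∈ X) (verts w)

  IsConnectedDominating : Subset n → Set
  IsConnectedDominating X = Dominating X × InducesConnected X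

  IsGammaC : ℕ → Set
  IsGammaC g = (∃[ X ] (IsConnectedDominating X × ∣ X ∣ ≡ g))
             × (∀ X → IsConnectedDominating X → g ≤ ∣ X ∣)

{-# OPTIONS --safe #-}
-- Complementing a maximum total mutual-visibility set X gives a connected
-- dominating set: a vertex of X has a neighbour outside X, namely the first
-- internal vertex of an X-avoiding shortest path to a non-neighbour (or, if it
-- is adjacent to everything, of such a path between a non-adjacent pair), and
-- the X-avoiding shortest paths themselves connect V ∖ X. Its size is
-- n − μ_t = diam − 1. Conversely every connected dominating set X has at least
-- diam − 1 vertices, since a diametral pair is joined through a path inside X
-- that is extended by at most one edge at each end.
module Submission where

open import Defs
open import Data.Empty using (⊥-elim)
open import Data.Fin using (Fin)
open import Data.Fin.Properties using (_≟_; any?)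
open import Data.Fin.Subset using (Subset; _∈_; _∉_; ∣_∣; ∁; _-_)
open import Data.Fin.Subset.Properties
  using (x∉p⇒x∈∁p; ∣∁p∣≡n∸∣p∣; x∈p∧x≢y⇒x∈p-y; x∈p⇒∣p-x∣<∣p∣) renaming (_∈?_ to _∈ˢ?_)
open import Data.List using (List; []; _∷_; _++_; length)
open import Data.List.Membership.Propositional using () renaming (_∈_ to _∈ˡ_)
open import Data.List.Relation.Unary.All as All using (All; []; _∷_)
open import Data.List.Relation.Unary.All.Properties using (¬Any⇒All¬; ++⁻ʳ)
open import Data.List.Relation.Unary.Any as Any using ()
open import Data.List.Relation.Unary.AllPairs using ([]; _∷_)
open import Data.List.Relation.Unary.Unique.Propositional using (Unique)
open import Data.Nat using (ℕ; suc; _+_; _∸_; _≤_; z≤n; s≤s)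
open import Data.Nat.Properties
  using (≤-refl; ≤-trans; ≤-antisym; +-comm; +-mono-≤; ∸-+-assoc; ∸-monoˡ-≤;
         m≤n+o⇒m∸n≤o; m≤n+m∸n; module ≤-Reasoning)
open import Data.Product using (∃₂; ∃-syntax; _×_; _,_)
open import Data.Sum using (inj₁; inj₂)
open import Function using (_∘_)
open import Relation.Nullary using (¬_; yes; no)
open import Relation.Nullary.Decidable using (¬?; _×-dec_)
open import Relation.Binary.PropositionalEquality using (_≡_; _≢_; refl; sym; cong; subst)

Unique-++⁻ʳ : ∀ {A : Set} (xs : List A) {ys : List A} → Unique (xs ++ ys) → Unique ys
Unique-++⁻ʳ []       u       = u
Unique-++⁻ʳ (x ∷ xs) (_ ∷ u) = Unique-++⁻ʳ xs u

Unique⇒length≤∣∣ : ∀ {n} {p : Subset n} {xs : List (Fin n)} →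
                   Unique xs → All (_∈ p) xs → length xs ≤ ∣ p ∣
Unique⇒length≤∣∣             []                 []         = z≤n
Unique⇒length≤∣∣ {p = p} {x ∷ _} (x∉xs ∷ unique) (x∈p ∷ xs⊆p) =
  ≤-trans (s≤s (Unique⇒length≤∣∣ unique xs⊆p-x)) (x∈p⇒∣p-x∣<∣p∣ x∈p)
  where
  xs⊆p-x : All (_∈ p - x) _
  xs⊆p-x = All.zipWith (λ (y∈p , x≢y) → x∈p∧x≢y⇒x∈p-y y∈p (x≢y ∘ sym)) (xs⊆p , x∉xs)

n∸[n∸D+1]≤D∸1 : ∀ n D → n ∸ (n ∸ D + 1) ≤ D ∸ 1
n∸[n∸D+1]≤D∸1 n D = begin
  n ∸ (n ∸ D + 1)   ≡⟨ ∸-+-assoc n (n ∸ D) 1 ⟨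
  n ∸ (n ∸ D) ∸ 1   ≤⟨ ∸-monoˡ-≤ 1 n∸[n∸D]≤D ⟩
  D ∸ 1             ∎
  where
  open ≤-Reasoning
  n∸[n∸D]≤D : n ∸ (n ∸ D) ≤ D
  n∸[n∸D]≤D = m≤n+o⇒m∸n≤o n (n ∸ D) (subst (n ≤_) (+-comm D (n ∸ D)) (m≤n+m∸n n D))

module _ {n : ℕ} (G : Graph n) where
  open Graph G

  _++ʷ_ : ∀ {x y z k l} → Walk G x y k → Walk G y z l → Walk G x z (k + l)
  here     ++ʷ w′ = w′
  step e w ++ʷ w′ = step e (w ++ʷ w′)

  length-verts : ∀ {x y k} (w : Walk G x y k) → length (verts G w) ≡ suc k
  length-verts here       = refl
  length-verts (step _ w) = cong suc (length-verts w)

  suffix : ∀ {v x z k} (w : Walk G x z k) → v ∈ˡ verts G w →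
           ∃[ pre ] ∃₂ λ k′ (w′ : Walk G v z k′) → verts G w ≡ pre ++ verts G w′
  suffix here       (Any.here refl) = [] , _ , here , refl
  suffix (step e w) (Any.here refl) = [] , _ , step e w , refl
  suffix (step {x} e w) (Any.there v∈w) with suffix w v∈w
  ... | pre , k′ , w′ , eq = x ∷ pre , k′ , w′ , cong (x ∷_) eq

  PathIn : (Fin n → Set) → Fin n → Fin n → Set
  PathIn P x z = ∃₂ λ k (w : Walk G x z k) → Unique (verts G w) × All P (verts G w)

  loop-erase : ∀ {P x z k} (w : Walk G x z k) → All P (verts G w) → PathIn P x z
  loop-erase here Px = 0 , here , [] ∷ [] , Px
  loop-erase {P} (step {x} e w) (Px ∷ Pw) with loop-erase w Pw
  ... | k , p , unique , Pp with Any.any? (x ≟_) (verts G p)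
  ...   | no x∉p  = suc k , step e p , ¬Any⇒All¬ _ x∉p ∷ unique , Px ∷ Pp
  ...   | yes x∈p with suffix p x∈p
  ...     | pre , k′ , p′ , eq =
    k′ , p′ , Unique-++⁻ʳ pre (subst Unique eq unique) , ++⁻ʳ pre (subst (All P) eq Pp)

  dominator : ∀ {X} → Dominating G X → ∀ v →
              ∃[ a ] a ∈ X × ∃[ l ] l ≤ 1 × Walk G v a l × Walk G a v l
  dominator dom v with dom v
  ... | inj₁ v∈X             = v , v∈X , 0 , z≤n , here , here
  ... | inj₂ (a , a∈X , a~v) = a , a∈X , 1 , ≤-refl , step (~-sym a~v) here , step a~v here

  connectedDominating⇒dist≤1+∣∣ : ∀ {X x y d} → IsConnectedDominating G X →
                                  IsDist G x y d → d ≤ 1 + ∣ X ∣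
  connectedDominating⇒dist≤1+∣∣ {X} {x} {y} {d} (dom , conn) (_ , shortest)
    with dominator dom x | dominator dom y
  ... | a , a∈X , la , la≤1 , x→a , _ | b , b∈X , lb , lb≤1 , _ , b→y
    with conn a b a∈X b∈X
  ... | _ , a→b , a→b⊆X with loop-erase a→b a→b⊆X
  ... | k , p , unique , p⊆X = begin
    d                 ≤⟨ shortest _ (x→a ++ʷ (p ++ʷ b→y)) ⟩
    la + (k + lb)     ≤⟨ +-mono-≤ la≤1 (+-mono-≤ (≤-refl {k}) lb≤1) ⟩
    1 + (k + 1)       ≡⟨ cong suc (+-comm k 1) ⟩
    1 + suc k         ≤⟨ s≤s |p|≤∣X∣ ⟩
    1 + ∣ X ∣         ∎
    where
    open ≤-Reasoning
    |p|≤∣X∣ : suc k ≤ ∣ X ∣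
    |p|≤∣X∣ = subst (_≤ ∣ X ∣) (length-verts p) (Unique⇒length≤∣∣ unique p⊆X)

  diam∸1≤∣connectedDominating∣ : ∀ {D X} → IsDiam G D → IsConnectedDominating G X →
                                 D ∸ 1 ≤ ∣ X ∣
  diam∸1≤∣connectedDominating∣ ((_ , _ , dist) , _) cds =
    m≤n+o⇒m∸n≤o _ 1 (connectedDominating⇒dist≤1+∣∣ cds dist)

  visible-nonadjacent⇒neighbour∉ : ∀ {X x y} → Visible G X x y → x ≢ y → ¬ x ~ y →
                                   ∃[ u ] x ~ u × u ∉ X
  visible-nonadjacent⇒neighbour∉ (_ , here , _)                    x≢y _   = ⊥-elim (x≢y refl)
  visible-nonadjacent⇒neighbour∉ (_ , step x~y here , _)           _   x≁y = ⊥-elim (x≁y x~y)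
  visible-nonadjacent⇒neighbour∉ (_ , step x~u (step _ _) , _ , u∉X ∷ _) _ _ = _ , x~u , u∉X

  totalMutualVisibility⇒∁-dominating : ∀ {X} → NonComplete G →
    IsTotalMutualVisibility G X → Dominating G (∁ X)
  totalMutualVisibility⇒∁-dominating {X} (p , q , p≢q , p≁q) tmv v with v ∈ˢ? X
  ... | no v∉X = inj₁ (x∉p⇒x∈∁p v∉X)
  ... | yes v∈X with any? (λ w → ¬? (v ≟ w) ×-dec ¬? (~-dec v w))
  ... | yes (w , v≢w , v≁w) with visible-nonadjacent⇒neighbour∉ (tmv v w) v≢w v≁w
  ...   | u , v~u , u∉X = inj₂ (u , x∉p⇒x∈∁p u∉X , ~-sym v~u)
  totalMutualVisibility⇒∁-dominating {X} (p , q , p≢q , p≁q) tmv v | yes v∈X | no v-universal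
    with visible-nonadjacent⇒neighbour∉ (tmv p q) p≢q p≁q
  ... | u , _ , u∉X with ~-dec v u
  ...   | yes v~u = inj₂ (u , x∉p⇒x∈∁p u∉X , ~-sym v~u)
  ...   | no v≁u  = ⊥-elim (v-universal (u , v≢u , v≁u))
    where
    v≢u : v ≢ u
    v≢u refl = u∉X v∈X

  initVerts∷last : ∀ {P : Fin n → Set} {x z k} (w : Walk G x z k) →
                   All P (initVerts G w) → P z → All P (verts G w)
  initVerts∷last here       []        Pz = Pz ∷ []
  initVerts∷last (step _ w) (Px ∷ Pw) Pz = Px ∷ initVerts∷last w Pw Pz

  totalMutualVisibility⇒∁-inducesConnected : ∀ {X} → IsTotalMutualVisibility G X →
                                             InducesConnected G (∁ X)
  totalMutualVisibility⇒∁-inducesConnected tmv x y x∈∁X y∈∁X with tmv x y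
  ... | d , here , _ , _             = d , here , x∈∁X ∷ []
  ... | d , step e w , _ , internal∉X =
    d , step e w , x∈∁X ∷ initVerts∷last w (All.map x∉p⇒x∈∁p internal∉X) y∈∁X

corollary2p5 : (n : ℕ) (G : Graph n) → Connected G → NonComplete G →
    (m D : ℕ) → IsMuT G m → IsDiam G D →
    m ≡ n ∸ D + 1 → IsGammaC G (D ∸ 1)
corollary2p5 n G _ nonComplete m D ((X , tmv , ∣X∣≡m) , _) diam m≡n∸D+1 =
  (∁ X , ∁X-cds , ≤-antisym ∣∁X∣≤D∸1 (diam∸1≤∣connectedDominating∣ G diam ∁X-cds)) ,
  λ Y Y-cds → diam∸1≤∣connectedDominating∣ G diam Y-cds
  where
  ∁X-cds : IsConnectedDominating G (∁ X)
  ∁X-cds = totalMutualVisibility⇒∁-dominating G nonComplete tmv ,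
           totalMutualVisibility⇒∁-inducesConnected G tmv
  ∣∁X∣≤D∸1 : ∣ ∁ X ∣ ≤ D ∸ 1
  ∣∁X∣≤D∸1 rewrite ∣∁p∣≡n∸∣p∣ X | ∣X∣≡m | m≡n∸D+1 = n∸[n∸D+1]≤D∸1 n D
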